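{- Let $M$ be an $n\times n$ $k$-uniform binary matrix. (i) For a given $j$ with $1\le j\le n-1$, every assignment mapping $\phi_j$ that acts as the identity on $X_{1,1}^j$ is optimal if and only if the canonical word $w_j=a^pb^p$, where $p=|X_{1,0}^j|$. (ii) If $j\in\{1,2,n-2,n-1\}$ or $k\in\{1,2,n-2,n-1\}$, then every assignment mapping $\phi_j$ that acts as the identity on $X_{1,1}^j$ is optimal.
   Context: For an $n\times n$ binary matrix $M=(m_{i,j})$ ($1\le i,j\le n$), $M$ is $k$-uniform if every row and column contains exactly $k$ ones. For $1\le j\le n-1$: $S_{i,j}=\sum_{l=1}^{j}m_{i,l}$; $X_{1,1}^j=\{i:m_{i,j}=m_{i,j+1}=1\}$, $X_{1,0}^j=\{i:m_{i,j}=1,m_{i,j+1}=0\}$, $X_{0,1}^j=\{i:m_{i,j}=0,m_{i,j+1}=1\}$. An assignment mapping $\phi_j$ is a one-to-one map from $\{i:m_{i,j}=1\}$ onto $\{i:m_{i,j+1}=1\}$; it is optimal if (1) $\phi_j(i)=i\iff m_{i,j}=m_{i,j+1}=1$ for all $i$ in its domain, and (2) $S_{\phi_j(i),j}\le S_{i,j}$ for all $i$ in its domain. The canonical word $w_j$ over $\{a,b\}$: list the elements of $X_{1,0}^j\cup X_{0,1}^j$ in non-increasing order of $S_{i,j}$, where among equal sums elements of $X_{1,0}^j$ precede those of $X_{0,1}^j$ (ties within one set broken by index), and let the $r$-th letter be $a$ if the $r$-th listed element is in $X_{1,0}^j$ and $b$ otherwise. -}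

module Defs where

open import Data.Nat using (ℕ; zero; suc; _+_; _≤_; _<_; _<?_; _≡ᵇ_; _<ᵇ_; _≤ᵇ_)
open import Data.Bool using (Bool; true; false; if_then_else_; _∧_; _∨_; not)
open import Data.Fin using (Fin; toℕ; fromℕ<)
open import Data.Nat.ListAction using (sum)
open import Data.List using (List; []; _∷_; map; filter; length; allFin; replicate; _++_)
open import Data.Product using (_×_; ∃)
open import Relation.Nullary using (yes; no)
open import Relation.Binary.PropositionalEquality using (_≡_)
open import Function.Bundles using (_⇔_)

Matrix : ℕ → Set
Matrix n = Fin n → Fin n → Bool

b2n : Bool → ℕ
b2n true  = 1
b2n false = 0

rowSum : ∀ {n} → Matrix n → Fin n → ℕ
rowSum {n} M i = sum (map (λ l → b2n (M i l)) (allFin n))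

colSum : ∀ {n} → Matrix n → Fin n → ℕ
colSum {n} M l = sum (map (λ i → b2n (M i l)) (allFin n))

Uniform : (n k : ℕ) → Matrix n → Set
Uniform n k M = (∀ i → rowSum M i ≡ k) × (∀ l → colSum M l ≡ k)

-- m_{i,l} with the paper's 1-indexed columns l = 1..n (false outside that range).
ent : ∀ {n} → Matrix n → Fin n → ℕ → Bool
ent M i zero = false
ent {n} M i (suc l) with l <? n
... | yes p = M i (fromℕ< p)
... | no _  = false

S : ∀ {n} → Matrix n → Fin n → ℕ → ℕ
S M i zero    = 0
S M i (suc l) = S M i l + b2n (ent M i (suc l))

inX11 inX10 inX01 : ∀ {n} → Matrix n → ℕ → Fin n → Bool
inX11 M j i = ent M i j ∧ ent M i (suc j)
inX10 M j i = ent M i j ∧ not (ent M i (suc j))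
inX01 M j i = not (ent M i j) ∧ ent M i (suc j)

-- Assignment mapping φ_j: represented by a function Fin n → Fin n of which only
-- the restriction to the domain {i : m_{i,j} = 1} matters; that restriction must be
-- a bijection onto {i : m_{i,j+1} = 1}.
IsAssignment : ∀ {n} → Matrix n → ℕ → (Fin n → Fin n) → Set
IsAssignment M j φ =
  (∀ i → ent M i j ≡ true → ent M (φ i) (suc j) ≡ true) ×
  (∀ i i' → ent M i j ≡ true → ent M i' j ≡ true → φ i ≡ φ i' → i ≡ i') ×
  (∀ i' → ent M i' (suc j) ≡ true → ∃ λ i → ent M i j ≡ true × φ i ≡ i')

IdOnX11 : ∀ {n} → Matrix n → ℕ → (Fin n → Fin n) → Set
IdOnX11 M j φ = ∀ i → ent M i j ≡ true → ent M i (suc j) ≡ true → φ i ≡ i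

Optimal : ∀ {n} → Matrix n → ℕ → (Fin n → Fin n) → Set
Optimal M j φ = ∀ i → ent M i j ≡ true →
  ((φ i ≡ i) ⇔ (ent M i j ≡ true × ent M i (suc j) ≡ true)) ×
  (S M (φ i) j ≤ S M i j)

data Letter : Set where
  a b : Letter

listedBefore : ∀ {n} → Matrix n → ℕ → Fin n → Fin n → Bool
listedBefore M j x y =
  (S M y j <ᵇ S M x j) ∨
  ((S M x j ≡ᵇ S M y j) ∧
    ((inX10 M j x ∧ inX01 M j y) ∨
     ((inX10 M j x ≡ᵇB inX10 M j y) ∧ (toℕ x ≤ᵇ toℕ y))))
  where
  _≡ᵇB_ : Bool → Bool → Bool
  true  ≡ᵇB c = c
  false ≡ᵇB c = not c

insertBy : ∀ {A : Set} → (A → A → Bool) → A → List A → List A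
insertBy le x [] = x ∷ []
insertBy le x (y ∷ ys) = if le x y then x ∷ y ∷ ys else y ∷ insertBy le x ys

sortBy : ∀ {A : Set} → (A → A → Bool) → List A → List A
sortBy le [] = []
sortBy le (x ∷ xs) = insertBy le x (sortBy le xs)

canonicalList : ∀ {n} → Matrix n → ℕ → List (Fin n)
canonicalList {n} M j =
  sortBy (listedBefore M j)
    (filter (λ i → inX10 M j i ∨ inX01 M j i Data.Bool.≟ true) (allFin n))
  where import Data.Bool

canonicalWord : ∀ {n} → Matrix n → ℕ → List Letter
canonicalWord M j = map (λ i → if inX10 M j i then a else b) (canonicalList M j)

sizeX10 : ∀ {n} → Matrix n → ℕ → ℕ
sizeX10 {n} M j = length (filter (λ i → inX10 M j i Data.Bool.≟ true) (allFin n))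
  where import Data.Bool

AllIdAssignmentsOptimal : ∀ {n} → Matrix n → ℕ → Set
AllIdAssignmentsOptimal {n} M j =
  (φ : Fin n → Fin n) → IsAssignment M j φ → IdOnX11 M j φ → Optimal M j φ

-- Say that X10 dominates X01 when every row of X_{1,0}^j has partial sum S_{·,j} at least that
-- of every row of X_{0,1}^j. An assignment fixing X_{1,1}^j is injective and already hits
-- X_{1,1}^j, so it maps X_{1,0}^j into X_{0,1}^j; hence dominance makes every such assignment
-- optimal. Conversely, columns j and j+1 both contain k ones, so |X_{1,0}^j| = |X_{0,1}^j| and any
-- x ∈ X_{1,0}^j can be sent to any y ∈ X_{0,1}^j by such an assignment (pair the two row lists,
-- then compose with a transposition); if all of them are optimal, X10 dominates X01. The
-- canonical list is sorted by decreasing S with X_{1,0}^j first on ties, so its word is aᵖbᵖ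
-- exactly when no b precedes an a, which is again dominance.
-- For (ii), take x ∈ X_{1,0}^j, y ∈ X_{0,1}^j, sx = S_{x,j} and sy = S_{y,j}. Row y has a 0 in
-- column j and a 1 in column j+1, row x the opposite, so sy < j, sy < k, 1 ≤ sx and
-- k ≤ sx + (n - j - 1). These constraints are symmetric in j and k, and each boundary value
-- of j (or of k) forces sy ≤ sx.

module Submission where

open import Data.Bool using (Bool; true; false; not; _∧_; _∨_; T; if_then_else_) renaming (_≟_ to _≟ᵇ_)
open import Data.Bool.Properties using (∧-comm; ∧-zeroʳ; ∨-zeroʳ; T-≡)
open import Data.Empty using (⊥-elim)
open import Data.Fin as Fin using (Fin; toℕ; fromℕ<; _≟_)
open import Data.Fin.Permutation.Components using (transpose; transpose-inverse)
open import Data.Fin.Properties using (toℕ<n; fromℕ<-toℕ)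
open import Data.List
  using (List; []; _∷_; [_]; _++_; map; filter; length; replicate; allFin; tabulate; applyUpTo)
open import Data.List.Properties using (map-cong; map-∘; map-tabulate; applyUpTo-∷ʳ)
open import Data.List.Membership.Propositional using (_∈_; _∉_)
open import Data.List.Membership.Propositional.Properties using (∈-filter⁺; ∈-filter⁻; ∈-allFin)
open import Data.List.Relation.Binary.Permutation.Propositional as ↭ using (_↭_; ↭-sym)
open import Data.List.Relation.Binary.Permutation.Propositional.Properties
  using (All-resp-↭; ∈-resp-↭) renaming (map⁺ to ↭-map⁺)
open import Data.List.Relation.Unary.All using (All; []; _∷_; universal) renaming (lookup to All-lookup)
open import Data.List.Relation.Unary.All.Properties using (all-filter; replicate⁺)
open import Data.List.Relation.Unary.AllPairs as AllPairs using (AllPairs; []; _∷_)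
import Data.List.Relation.Unary.AllPairs.Properties as AllPairs
open import Data.List.Relation.Unary.Any using (here; there)
open import Data.List.Relation.Unary.Unique.Propositional using (Unique)
import Data.List.Relation.Unary.Unique.Propositional.Properties as Unique
open import Data.Nat using (ℕ; zero; suc; _+_; _≤_; _<_; z≤n; s≤s; _<?_; _<ᵇ_; _≡ᵇ_; _≤ᵇ_)
open import Data.Nat.ListAction using (sum)
open import Data.Nat.ListAction.Properties using (sum-++; sum-↭)
open import Data.Nat.Properties
  using (+-comm; +-assoc; +-suc; +-identityʳ; +-cancelˡ-≡; +-cancelˡ-<; +-mono-≤; +-monoʳ-≤;
         ≤-refl; ≤-reflexive; ≤-trans; ≤-total; ≤-pred; <-trans; <-≤-trans; <-cmp; <⇒≤; <⇒≱;
         n<1+n; m≤m+n; m≤n+m; suc-injective; m≤n⇒∃[o]m+o≡n;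
         <ᵇ⇒<; <⇒<ᵇ; ≡ᵇ⇒≡; ≡⇒≡ᵇ; ≤ᵇ⇒≤; ≤⇒≤ᵇ; module ≤-Reasoning)
open import Data.Product using (_×_; _,_; proj₁; proj₂; ∃; map₂)
open import Data.Sum as Sum using (_⊎_; inj₁; inj₂)
open import Function using (_∘_)
open import Function.Bundles using (_⇔_; mk⇔; Equivalence)
open import Relation.Binary.Definitions using (tri<; tri≈; tri>)
open import Relation.Binary.PropositionalEquality
  using (_≡_; _≢_; refl; sym; trans; cong; cong₂; subst; subst₂; module ≡-Reasoning)
open import Relation.Nullary using (Dec; yes; no)

open import Defs

-- Counting

-- A sum rather than `length ∘ filter`, so that `colSum M l` is literally
-- `count (λ i → M i l) (allFin n)`.
count : ∀ {A : Set} → (A → Bool) → List A → ℕ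
count g xs = sum (map (λ x → b2n (g x)) xs)

module _ {A : Set} where

  count-cong : ∀ {g h : A → Bool} → (∀ x → g x ≡ h x) → ∀ xs → count g xs ≡ count h xs
  count-cong g≗h xs = cong sum (map-cong (λ x → cong b2n (g≗h x)) xs)

  count-↭ : ∀ (g : A → Bool) {xs ys} → xs ↭ ys → count g xs ≡ count g ys
  count-↭ g xs↭ys = sum-↭ (↭-map⁺ (λ x → b2n (g x)) xs↭ys)

  count-split : ∀ (g h : A → Bool) xs →
    count g xs ≡ count (λ x → g x ∧ h x) xs + count (λ x → g x ∧ not (h x)) xs
  count-split g h [] = refl
  count-split g h (x ∷ xs) with g x | h x
  ... | false | _     = count-split g h xs
  ... | true  | true  = cong suc (count-split g h xs)
  ... | true  | false = trans (cong suc (count-split g h xs)) (sym (+-suc _ _))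

  length-filter≡count : ∀ (g : A → Bool) xs → length (filter (λ x → g x ≟ᵇ true) xs) ≡ count g xs
  length-filter≡count g [] = refl
  length-filter≡count g (x ∷ xs) with g x
  ... | true  = cong suc (length-filter≡count g xs)
  ... | false = length-filter≡count g xs

  count-filter : ∀ (g h : A → Bool) xs →
    count g (filter (λ x → h x ≟ᵇ true) xs) ≡ count (λ x → h x ∧ g x) xs
  count-filter g h [] = refl
  count-filter g h (x ∷ xs) with h x
  ... | true  = cong (b2n (g x) +_) (count-filter g h xs)
  ... | false = count-filter g h xs

-- Insertion sort and pairwise-ordered lists

module _ {A : Set} (le : A → A → Bool) where

  insertBy-↭ : ∀ x ys → insertBy le x ys ↭ x ∷ ys
  insertBy-↭ x [] = ↭.refl
  insertBy-↭ x (y ∷ ys) with le x y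
  ... | true  = ↭.refl
  ... | false = ↭.trans (↭.prep y (insertBy-↭ x ys)) (↭.swap y x ↭.refl)

  sortBy-↭ : ∀ xs → sortBy le xs ↭ xs
  sortBy-↭ [] = ↭.refl
  sortBy-↭ (x ∷ xs) = ↭.trans (insertBy-↭ x (sortBy le xs)) (↭.prep x (sortBy-↭ xs))

  module _ {P : A → Set}
    (total : ∀ {x y} → P x → P y → le x y ≡ false → le y x ≡ true)
    (transitive : ∀ {x y z} → P x → P y → P z → le x y ≡ true → le y z ≡ true → le x z ≡ true)
    where

    private
      _≤ₗₑ_ : A → A → Set
      x ≤ₗₑ y = le x y ≡ true

    insertBy-sorted : ∀ {x ys} → P x → All P ys → AllPairs _≤ₗₑ_ ys → AllPairs _≤ₗₑ_ (insertBy le x ys)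
    insertBy-sorted {ys = []} _ _ _ = [] ∷ []
    insertBy-sorted {x} {y ∷ ys} px (py ∷ pys) (y≤ys ∷ ys-sorted) with le x y in x≤y
    ... | true  = (x≤y ∷ x≤ys pys y≤ys) ∷ y≤ys ∷ ys-sorted
      where
      x≤ys : ∀ {zs} → All P zs → All (y ≤ₗₑ_) zs → All (x ≤ₗₑ_) zs
      x≤ys [] [] = []
      x≤ys (pz ∷ pzs) (y≤z ∷ y≤zs) = transitive px py pz x≤y y≤z ∷ x≤ys pzs y≤zs
    ... | false =
      All-resp-↭ (↭-sym (insertBy-↭ x ys)) (total px py x≤y ∷ y≤ys) ∷ insertBy-sorted px pys ys-sorted

    sortBy-sorted : ∀ {xs} → All P xs → AllPairs _≤ₗₑ_ (sortBy le xs)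
    sortBy-sorted [] = []
    sortBy-sorted {_ ∷ xs} (px ∷ pxs) =
      insertBy-sorted px (All-resp-↭ (↭-sym (sortBy-↭ xs)) pxs) (sortBy-sorted pxs)

module _ {A : Set} {R : A → A → Set} where

  AllPairs⇒∈-related : ∀ {xs x y} → AllPairs R xs → x ∈ xs → y ∈ xs → x ≡ y ⊎ R x y ⊎ R y x
  AllPairs⇒∈-related (_ ∷ _) (here refl) (here refl) = inj₁ refl
  AllPairs⇒∈-related (Rx ∷ _) (here refl) (there y∈) = inj₂ (inj₁ (All-lookup Rx y∈))
  AllPairs⇒∈-related (Rx ∷ _) (there x∈) (here refl) = inj₂ (inj₂ (All-lookup Rx x∈))
  AllPairs⇒∈-related (_ ∷ R-xs) (there x∈) (there y∈) = AllPairs⇒∈-related R-xs x∈ y∈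

  AllPairs-mapWith : ∀ {S : A → A → Set} {P : A → Set} →
    (∀ {x y} → P x → P y → R x y → S x y) → ∀ {xs} → All P xs → AllPairs R xs → AllPairs S xs
  AllPairs-mapWith R⇒S [] [] = []
  AllPairs-mapWith {S} {P} R⇒S (px ∷ pxs) (Rx ∷ R-xs) = S-head pxs Rx ∷ AllPairs-mapWith R⇒S pxs R-xs
    where
    S-head : ∀ {ys} → All P ys → All (R _) ys → All (S _) ys
    S-head [] [] = []
    S-head (py ∷ pys) (r ∷ rs) = R⇒S px py r ∷ S-head pys rs

-- Words of the form aᵖ bᵠ

data _≼_ : Letter → Letter → Set where
  a≼ : ∀ {l} → a ≼ l
  b≼b : b ≼ b

isA isB : Letter → Bool
isA a = true
isA b = false
isB l = not (isA l)

all-b⇒replicate : ∀ {w} → All (b ≼_) w → count isA w ≡ 0 × w ≡ replicate (count isB w) b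
all-b⇒replicate [] = refl , refl
all-b⇒replicate (b≼b ∷ b≼w) = map₂ (cong (b ∷_)) (all-b⇒replicate b≼w)

sorted⇒replicate : ∀ {w} → AllPairs _≼_ w → w ≡ replicate (count isA w) a ++ replicate (count isB w) b
sorted⇒replicate [] = refl
sorted⇒replicate {a ∷ w} (_ ∷ w-sorted) = cong (a ∷_) (sorted⇒replicate w-sorted)
sorted⇒replicate {b ∷ w} (b≼w ∷ _) with all-b⇒replicate b≼w
... | no-a , w≡bs rewrite no-a = cong (b ∷_) w≡bs

replicate-sorted : ∀ p q → AllPairs _≼_ (replicate p a ++ replicate q b)
replicate-sorted (suc p) q = universal (λ _ → a≼) _ ∷ replicate-sorted p q
replicate-sorted zero zero = []
replicate-sorted zero (suc q) = replicate⁺ q b≼b ∷ replicate-sorted zero q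

-- The canonical order

Key : Set
Key = ℕ × Bool × ℕ

data _⊑_ : Key → Key → Set where
  by-sum   : ∀ {s c i s′ c′ i′} → s′ < s → (s , c , i) ⊑ (s′ , c′ , i′)
  by-class : ∀ {s i i′} → (s , true , i) ⊑ (s , false , i′)
  by-index : ∀ {s c i i′} → i ≤ i′ → (s , c , i) ⊑ (s , c , i′)

-- `tieᵇ` and `lexᵇ` are shaped like `listedBefore`, so that on rows of X10 ∪ X01 they agree
-- with it by computation.
tieᵇ : Bool → Bool → ℕ → ℕ → Bool
tieᵇ true  false _ _  = true
tieᵇ false true  _ _  = false
tieᵇ _     _     i i′ = i ≤ᵇ i′

lexᵇ : Key → Key → Bool
lexᵇ (s , c , i) (s′ , c′ , i′) = (s′ <ᵇ s) ∨ ((s ≡ᵇ s′) ∧ tieᵇ c c′ i i′)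

private
  T⇒≡ : ∀ {b} → T b → b ≡ true
  T⇒≡ = Equivalence.to T-≡

  ≡⇒T : ∀ {b} → b ≡ true → T b
  ≡⇒T = Equivalence.from T-≡

lexᵇ-sound : ∀ {k k′} → lexᵇ k k′ ≡ true → k ⊑ k′
lexᵇ-sound {s , c , i} {s′ , c′ , i′} h with s′ <ᵇ s in s′<ᵇs
... | true = by-sum (<ᵇ⇒< s′ s (≡⇒T s′<ᵇs))
... | false with s ≡ᵇ s′ in s≡ᵇs′
...   | true with refl ← ≡ᵇ⇒≡ s s′ (≡⇒T s≡ᵇs′) = tie-sound c c′ h
  where
  tie-sound : ∀ c c′ → tieᵇ c c′ i i′ ≡ true → (s , c , i) ⊑ (s , c′ , i′)
  tie-sound true  false _ = by-class
  tie-sound true  true  h = by-index (≤ᵇ⇒≤ i i′ (≡⇒T h))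
  tie-sound false false h = by-index (≤ᵇ⇒≤ i i′ (≡⇒T h))

lexᵇ-complete : ∀ {k k′} → k ⊑ k′ → lexᵇ k k′ ≡ true
lexᵇ-complete (by-sum s′<s) rewrite T⇒≡ (<⇒<ᵇ s′<s) = refl
lexᵇ-complete (by-class {s}) rewrite T⇒≡ (≡⇒≡ᵇ s s refl) = ∨-zeroʳ (s <ᵇ s)
lexᵇ-complete (by-index {s} {true} i≤i′)
  rewrite T⇒≡ (≡⇒≡ᵇ s s refl) | T⇒≡ (≤⇒≤ᵇ i≤i′) = ∨-zeroʳ (s <ᵇ s)
lexᵇ-complete (by-index {s} {false} i≤i′)
  rewrite T⇒≡ (≡⇒≡ᵇ s s refl) | T⇒≡ (≤⇒≤ᵇ i≤i′) = ∨-zeroʳ (s <ᵇ s)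

⊑-total : ∀ k k′ → k ⊑ k′ ⊎ k′ ⊑ k
⊑-total (s , c , i) (s′ , c′ , i′) with <-cmp s s′
... | tri< s<s′ _ _ = inj₂ (by-sum s<s′)
... | tri> _ _ s′<s = inj₁ (by-sum s′<s)
... | tri≈ _ refl _ = by-tie c c′
  where
  by-tie : ∀ c c′ → (s , c , i) ⊑ (s , c′ , i′) ⊎ (s , c′ , i′) ⊑ (s , c , i)
  by-tie true  false = inj₁ by-class
  by-tie false true  = inj₂ by-class
  by-tie true  true  = Sum.map by-index by-index (≤-total i i′)
  by-tie false false = Sum.map by-index by-index (≤-total i i′)

⊑-trans : ∀ {k k′ k″} → k ⊑ k′ → k′ ⊑ k″ → k ⊑ k″
⊑-trans (by-sum p)   (by-sum q)   = by-sum (<-trans q p)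
⊑-trans (by-sum p)   by-class     = by-sum p
⊑-trans (by-sum p)   (by-index _) = by-sum p
⊑-trans by-class     (by-sum q)   = by-sum q
⊑-trans by-class     (by-index _) = by-class
⊑-trans (by-index _) (by-sum q)   = by-sum q
⊑-trans (by-index _) by-class     = by-class
⊑-trans (by-index p) (by-index q) = by-index (≤-trans p q)

lexᵇ-total : ∀ k k′ → lexᵇ k k′ ≡ false → lexᵇ k′ k ≡ true
lexᵇ-total k k′ h with ⊑-total k k′
... | inj₁ k⊑k′ with () ← trans (sym h) (lexᵇ-complete k⊑k′)
... | inj₂ k′⊑k = lexᵇ-complete k′⊑k

lexᵇ-trans : ∀ k k′ k″ → lexᵇ k k′ ≡ true → lexᵇ k′ k″ ≡ true → lexᵇ k k″ ≡ true
lexᵇ-trans k k′ k″ p q = lexᵇ-complete (⊑-trans (lexᵇ-sound {k} {k′} p) (lexᵇ-sound {k′} {k″} q))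

⊑⇒≥ : ∀ {k k′} → k ⊑ k′ → proj₁ k′ ≤ proj₁ k
⊑⇒≥ (by-sum s′<s) = <⇒≤ s′<s
⊑⇒≥ by-class = ≤-refl
⊑⇒≥ (by-index _) = ≤-refl

false⊑true⇒> : ∀ {s i s′ i′} → (s , false , i) ⊑ (s′ , true , i′) → s′ < s
false⊑true⇒> (by-sum s′<s) = s′<s

-- Matchings between lists of indices

module _ {n : ℕ} where

  record Matching (xs ys : List (Fin n)) (f : Fin n → Fin n) : Set where
    field
      fixes     : ∀ {i} → i ∉ xs → f i ≡ i
      maps      : ∀ {i} → i ∈ xs → f i ∈ ys
      injective : ∀ {i i′} → i ∈ xs → i′ ∈ xs → f i ≡ f i′ → i ≡ i′
      onto      : ∀ {y} → y ∈ ys → ∃ λ i → i ∈ xs × f i ≡ y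

  private
    ∈-tail : ∀ {i x : Fin n} {xs} → i ∈ x ∷ xs → i ≢ x → i ∈ xs
    ∈-tail (here i≡x) i≢x = ⊥-elim (i≢x i≡x)
    ∈-tail (there i∈xs) _ = i∈xs

  pairing : List (Fin n) → List (Fin n) → Fin n → Fin n
  pairing (x ∷ xs) (y ∷ ys) i with i ≟ x
  ... | yes _ = y
  ... | no _  = pairing xs ys i
  pairing _ _ i = i

  pairing-head : ∀ x xs y ys → pairing (x ∷ xs) (y ∷ ys) x ≡ y
  pairing-head x xs y ys with x ≟ x
  ... | yes _ = refl
  ... | no x≢x = ⊥-elim (x≢x refl)

  pairing-tail : ∀ {i : Fin n} x xs y ys → i ≢ x → pairing (x ∷ xs) (y ∷ ys) i ≡ pairing xs ys i
  pairing-tail {i} x xs y ys i≢x with i ≟ x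
  ... | yes i≡x = ⊥-elim (i≢x i≡x)
  ... | no _    = refl

  pairing-fixes : ∀ xs ys {i} → i ∉ xs → pairing xs ys i ≡ i
  pairing-fixes []       ys       _   = refl
  pairing-fixes (x ∷ xs) []       _   = refl
  pairing-fixes (x ∷ xs) (y ∷ ys) i∉ =
    trans (pairing-tail x xs y ys (i∉ ∘ here)) (pairing-fixes xs ys (i∉ ∘ there))

  pairing-maps : ∀ xs ys {i} → length xs ≡ length ys → i ∈ xs → pairing xs ys i ∈ ys
  pairing-maps (x ∷ xs) (y ∷ ys) {i} len i∈ with i ≟ x
  ... | yes _   = here refl
  ... | no  i≢x = there (pairing-maps xs ys (suc-injective len) (∈-tail i∈ i≢x))

  pairing-injective : ∀ xs ys {i i′} → length xs ≡ length ys → Unique ys →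
    i ∈ xs → i′ ∈ xs → pairing xs ys i ≡ pairing xs ys i′ → i ≡ i′
  pairing-injective (x ∷ xs) (y ∷ ys) {i} {i′} len (y∉ys ∷ ys-unique) i∈ i′∈ eq
    with i ≟ x | i′ ≟ x
  ... | yes i≡x | yes i′≡x = trans i≡x (sym i′≡x)
  ... | yes _   | no i′≢x  =
    ⊥-elim (All-lookup y∉ys (pairing-maps xs ys (suc-injective len) (∈-tail i′∈ i′≢x)) eq)
  ... | no i≢x  | yes _    =
    ⊥-elim (All-lookup y∉ys (pairing-maps xs ys (suc-injective len) (∈-tail i∈ i≢x)) (sym eq))
  ... | no i≢x  | no i′≢x  =
    pairing-injective xs ys (suc-injective len) ys-unique (∈-tail i∈ i≢x) (∈-tail i′∈ i′≢x) eq

  pairing-onto : ∀ xs ys {y′} → length xs ≡ length ys → Unique xs →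
    y′ ∈ ys → ∃ λ i → i ∈ xs × pairing xs ys i ≡ y′
  pairing-onto (x ∷ xs) (y ∷ ys) _ _ (here refl) = x , here refl , pairing-head x xs y ys
  pairing-onto (x ∷ xs) (y ∷ ys) len (x∉xs ∷ xs-unique) (there y′∈)
    with pairing-onto xs ys (suc-injective len) xs-unique y′∈
  ... | i , i∈ , eq = i , there i∈ , trans (pairing-tail x xs y ys (All-lookup x∉xs i∈ ∘ sym)) eq

  pairing-matching : ∀ {xs ys} → length xs ≡ length ys → Unique xs → Unique ys →
    Matching xs ys (pairing xs ys)
  pairing-matching {xs} {ys} len xs-unique ys-unique = record
    { fixes     = pairing-fixes xs ys
    ; maps      = pairing-maps xs ys len
    ; injective = pairing-injective xs ys len ys-unique
    ; onto      = pairing-onto xs ys len xs-unique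
    }

  transpose-source : ∀ (i j : Fin n) → transpose i j i ≡ j
  transpose-source i j with i ≟ i
  ... | yes _   = refl
  ... | no i≢i  = ⊥-elim (i≢i refl)

  transpose-fixes : ∀ {i j k : Fin n} → k ≢ i → k ≢ j → transpose i j k ≡ k
  transpose-fixes {i} {j} {k} k≢i k≢j with k ≟ i
  ... | yes k≡i = ⊥-elim (k≢i k≡i)
  ... | no _ with k ≟ j
  ...   | yes k≡j = ⊥-elim (k≢j k≡j)
  ...   | no _    = refl

  transpose-∈ : ∀ {i j k : Fin n} {xs} → i ∈ xs → j ∈ xs → k ∈ xs → transpose i j k ∈ xs
  transpose-∈ {i} {j} {k} i∈ j∈ k∈ with k ≟ i
  ... | yes _ = j∈
  ... | no _ with k ≟ j
  ...   | yes _ = i∈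
  ...   | no _  = k∈

  transpose-injective : ∀ (i j : Fin n) {k k′} → transpose i j k ≡ transpose i j k′ → k ≡ k′
  transpose-injective i j {k} {k′} eq =
    trans (sym (transpose-inverse j i)) (trans (cong (transpose j i) eq) (transpose-inverse j i))

  matching-∘-transpose : ∀ {xs ys f} {x x′ : Fin n} → Matching xs ys f → x ∈ xs → x′ ∈ xs →
    Matching xs ys (f ∘ transpose x x′)
  matching-∘-transpose {xs} {ys} {f} {x} {x′} m x∈ x′∈ = record
    { fixes     = λ i∉ → trans (cong f (transpose-fixes (λ { refl → i∉ x∈ }) (λ { refl → i∉ x′∈ })))
                               (fixes i∉)
    ; maps      = λ i∈ → maps (τ-∈ i∈)
    ; injective = λ i∈ i′∈ eq → transpose-injective x x′ (injective (τ-∈ i∈) (τ-∈ i′∈) eq)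
    ; onto      = λ y∈ → let i , i∈ , fi≡y = onto y∈ in
        transpose x′ x i , transpose-∈ x′∈ x∈ i∈ ,
        trans (cong f (transpose-inverse x x′)) fi≡y
    }
    where
    open Matching m
    τ-∈ : ∀ {i} → i ∈ xs → transpose x x′ i ∈ xs
    τ-∈ = transpose-∈ x∈ x′∈

  matching-through : ∀ {xs ys} {x y : Fin n} → length xs ≡ length ys → Unique xs → Unique ys →
    x ∈ xs → y ∈ ys → ∃ λ f → Matching xs ys f × f x ≡ y
  matching-through {xs} {ys} {x} len xs-unique ys-unique x∈ y∈
    with x′ , x′∈ , x′↦y ← Matching.onto (pairing-matching len xs-unique ys-unique) y∈ =
    pairing xs ys ∘ transpose x x′ ,
    matching-∘-transpose (pairing-matching len xs-unique ys-unique) x∈ x′∈ ,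
    trans (cong (pairing xs ys) (transpose-source x x′)) x′↦y

-- Dominance, optimal assignments and the canonical word

∧-not-intro : ∀ {p q} → p ≡ true → q ≡ false → p ∧ not q ≡ true
∧-not-intro refl refl = refl

not-∧-intro : ∀ {p q} → p ≡ false → q ≡ true → not p ∧ q ≡ true
not-∧-intro refl refl = refl

∧-not-elim : ∀ {p q} → p ∧ not q ≡ true → p ≡ true × q ≡ false
∧-not-elim {true} {false} _ = refl , refl

not-∧-elim : ∀ {p q} → not p ∧ q ≡ true → p ≡ false × q ≡ true
not-∧-elim {false} {true} _ = refl , refl

∧-not-false : ∀ {p q} → p ≡ true → p ∧ not q ≡ false → q ≡ true
∧-not-false {q = true} _ _ = refl
∧-not-false {q = false} refl ()

∧-not-true : ∀ {p q} → q ≡ true → p ∧ not q ≡ false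
∧-not-true {p} refl = ∧-zeroʳ p

module _ {n : ℕ} (M : Matrix n) (j : ℕ) where

  X10Dominates : Set
  X10Dominates = ∀ x y → inX10 M j x ≡ true → inX01 M j y ≡ true → S M y j ≤ S M x j

  X10⇒entries : ∀ {i} → inX10 M j i ≡ true → ent M i j ≡ true × ent M i (suc j) ≡ false
  X10⇒entries = ∧-not-elim

  X01⇒entries : ∀ {i} → inX01 M j i ≡ true → ent M i j ≡ false × ent M i (suc j) ≡ true
  X01⇒entries = not-∧-elim

  dominates⇒optimal : X10Dominates → AllIdAssignmentsOptimal M j
  dominates⇒optimal dominates φ (maps , injective , _) idX11 i i∈col =
    mk⇔ (λ φi≡i → i∈col , subst (λ r → ent M r (suc j) ≡ true) φi≡i φi∈next)
        (λ (p , q) → idX11 i p q) ,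
    sum-decreases
    where
    φi∈next : ent M (φ i) (suc j) ≡ true
    φi∈next = maps i i∈col

    φi∉col : ent M i (suc j) ≡ false → ent M (φ i) j ≡ false
    φi∉col i∉next with ent M (φ i) j in φi∈col
    ... | false = refl
    ... | true = trans (sym (subst (λ r → ent M r (suc j) ≡ true) φi≡i φi∈next)) i∉next
      where
      φi≡i : φ i ≡ i
      φi≡i = injective (φ i) i φi∈col i∈col (idX11 (φ i) φi∈col φi∈next)

    sum-decreases : S M (φ i) j ≤ S M i j
    sum-decreases with ent M i (suc j) in i∈next
    ... | true  = ≤-reflexive (cong (λ r → S M r j) (idX11 i i∈col i∈next))
    ... | false = dominates i (φ i) (∧-not-intro i∈col i∈next) (not-∧-intro (φi∉col i∈next) φi∈next)

  rowsX10 rowsX01 : List (Fin n)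
  rowsX10 = filter (λ i → inX10 M j i ≟ᵇ true) (allFin n)
  rowsX01 = filter (λ i → inX01 M j i ≟ᵇ true) (allFin n)

  ∈rowsX10 : ∀ {i} → inX10 M j i ≡ true → i ∈ rowsX10
  ∈rowsX10 {i} = ∈-filter⁺ (λ i → inX10 M j i ≟ᵇ true) (∈-allFin i)

  ∈rowsX01 : ∀ {i} → inX01 M j i ≡ true → i ∈ rowsX01
  ∈rowsX01 {i} = ∈-filter⁺ (λ i → inX01 M j i ≟ᵇ true) (∈-allFin i)

  rowsX10⊆X10 : ∀ {i} → i ∈ rowsX10 → inX10 M j i ≡ true
  rowsX10⊆X10 = proj₂ ∘ ∈-filter⁻ (λ i → inX10 M j i ≟ᵇ true) {xs = allFin n}

  rowsX01⊆X01 : ∀ {i} → i ∈ rowsX01 → inX01 M j i ≡ true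
  rowsX01⊆X01 = proj₂ ∘ ∈-filter⁻ (λ i → inX01 M j i ≟ᵇ true) {xs = allFin n}

  ∉rowsX10 : ∀ {i} → inX10 M j i ≡ false → i ∉ rowsX10
  ∉rowsX10 i∉X10 i∈rows with () ← trans (sym i∉X10) (rowsX10⊆X10 i∈rows)

  rowsX10-unique : Unique rowsX10
  rowsX10-unique = Unique.filter⁺ (λ i → inX10 M j i ≟ᵇ true) (Unique.allFin⁺ n)

  rowsX01-unique : Unique rowsX01
  rowsX01-unique = Unique.filter⁺ (λ i → inX01 M j i ≟ᵇ true) (Unique.allFin⁺ n)

  matching⇒assignment : ∀ {f} → Matching rowsX10 rowsX01 f → IsAssignment M j f × IdOnX11 M j f
  matching⇒assignment {f} m = (f-maps , f-injective , f-onto) , f-idX11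
    where
    open Matching m

    X10-image : ∀ {i} → inX10 M j i ≡ true → ent M (f i) j ≡ false × ent M (f i) (suc j) ≡ true
    X10-image = X01⇒entries ∘ rowsX01⊆X01 ∘ maps ∘ ∈rowsX10

    f-maps : ∀ i → ent M i j ≡ true → ent M (f i) (suc j) ≡ true
    f-maps i i∈col with inX10 M j i in i∈?X10
    ... | true  = proj₂ (X10-image i∈?X10)
    ... | false = subst (λ r → ent M r (suc j) ≡ true) (sym (fixes (∉rowsX10 i∈?X10)))
                        (∧-not-false i∈col i∈?X10)

    f-injective : ∀ i i′ → ent M i j ≡ true → ent M i′ j ≡ true → f i ≡ f i′ → i ≡ i′
    f-injective i i′ i∈col i′∈col fi≡fi′ with inX10 M j i in i∈?X10 | inX10 M j i′ in i′∈?X10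
    ... | true  | true  = injective (∈rowsX10 i∈?X10) (∈rowsX10 i′∈?X10) fi≡fi′
    ... | false | false = trans (sym (fixes (∉rowsX10 i∈?X10))) (trans fi≡fi′ (fixes (∉rowsX10 i′∈?X10)))
    ... | true  | false with () ← trans (sym (proj₁ (X10-image i∈?X10)))
        (trans (cong (λ r → ent M r j) (trans fi≡fi′ (fixes (∉rowsX10 i′∈?X10)))) i′∈col)
    ... | false | true with () ← trans (sym (proj₁ (X10-image i′∈?X10)))
        (trans (cong (λ r → ent M r j) (trans (sym fi≡fi′) (fixes (∉rowsX10 i∈?X10)))) i∈col)

    f-onto : ∀ i′ → ent M i′ (suc j) ≡ true → ∃ λ i → ent M i j ≡ true × f i ≡ i′
    f-onto i′ i′∈next with ent M i′ j in i′∈?col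
    ... | true  = i′ , i′∈?col , fixes (∉rowsX10 (∧-not-true i′∈next))
    ... | false with i , i∈rows , fi≡i′ ← onto (∈rowsX01 (not-∧-intro i′∈?col i′∈next))
      = i , proj₁ (X10⇒entries (rowsX10⊆X10 i∈rows)) , fi≡i′

    f-idX11 : IdOnX11 M j f
    f-idX11 i _ i∈next = fixes (∉rowsX10 (∧-not-true i∈next))

  optimal⇒dominates : length rowsX10 ≡ length rowsX01 → AllIdAssignmentsOptimal M j → X10Dominates
  optimal⇒dominates balanced optimal x y x∈X10 y∈X01
    with f , m , fx≡y ← matching-through balanced rowsX10-unique rowsX01-unique
                                          (∈rowsX10 x∈X10) (∈rowsX01 y∈X01)
    with f-assignment , f-idX11 ← matching⇒assignment m
    = subst (λ r → S M r j ≤ S M x j) fx≡y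
        (proj₂ (optimal f f-assignment f-idX11 x (proj₁ (X10⇒entries x∈X10))))

  Listed : Fin n → Set
  Listed i = (inX10 M j i ∨ inX01 M j i) ≡ true

  sortKey : Fin n → Key
  sortKey i = S M i j , inX10 M j i , toℕ i

  X10⇒listed : ∀ {i} → inX10 M j i ≡ true → Listed i
  X10⇒listed i∈X10 rewrite i∈X10 = refl

  X01⇒listed : ∀ {i} → inX01 M j i ≡ true → Listed i
  X01⇒listed {i} i∈X01 rewrite i∈X01 = ∨-zeroʳ (inX10 M j i)

  listedBefore≡lexᵇ : ∀ {x y} → Listed x → Listed y →
    listedBefore M j x y ≡ lexᵇ (sortKey x) (sortKey y)
  listedBefore≡lexᵇ {x} {y} x-listed y-listed
    with ent M x j | ent M x (suc j) | ent M y j | ent M y (suc j)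
  listedBefore≡lexᵇ () _  | true  | true  | _     | _
  listedBefore≡lexᵇ () _  | false | false | _     | _
  listedBefore≡lexᵇ _  () | _     | _     | true  | true
  listedBefore≡lexᵇ _  () | _     | _     | false | false
  ... | true  | false | true  | false = refl
  ... | true  | false | false | true  = refl
  ... | false | true  | true  | false = refl
  ... | false | true  | false | true  = refl

  listed? : (i : Fin n) → Dec (Listed i)
  listed? i = (inX10 M j i ∨ inX01 M j i) ≟ᵇ true

  _before_ : Fin n → Fin n → Set
  x before y = listedBefore M j x y ≡ true

  canonicalList-↭ : canonicalList M j ↭ filter listed? (allFin n)
  canonicalList-↭ = sortBy-↭ (listedBefore M j) _

  canonicalList-sorted : AllPairs _before_ (canonicalList M j)
  canonicalList-sorted = sortBy-sorted (listedBefore M j) total transitive (all-filter listed? (allFin n))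
    where
    total : ∀ {x y} → Listed x → Listed y → listedBefore M j x y ≡ false → y before x
    total {x} {y} x-listed y-listed x≰y = trans (listedBefore≡lexᵇ y-listed x-listed)
      (lexᵇ-total (sortKey x) (sortKey y) (trans (sym (listedBefore≡lexᵇ x-listed y-listed)) x≰y))
    transitive : ∀ {x y z} → Listed x → Listed y → Listed z → x before y → y before z → x before z
    transitive {x} {y} {z} x-listed y-listed z-listed x≤y y≤z = trans (listedBefore≡lexᵇ x-listed z-listed)
      (lexᵇ-trans (sortKey x) (sortKey y) (sortKey z)
        (trans (sym (listedBefore≡lexᵇ x-listed y-listed)) x≤y)
        (trans (sym (listedBefore≡lexᵇ y-listed z-listed)) y≤z))

  canonicalList-listed : All Listed (canonicalList M j)
  canonicalList-listed = All-resp-↭ (↭-sym canonicalList-↭) (all-filter listed? (allFin n))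

  ∈canonicalList : ∀ {i} → Listed i → i ∈ canonicalList M j
  ∈canonicalList {i} i-listed = ∈-resp-↭ (↭-sym canonicalList-↭) (∈-filter⁺ listed? (∈-allFin i) i-listed)

  letterOf : Fin n → Letter
  letterOf i = if inX10 M j i then a else b

  count-canonicalWord : ∀ g →
    count g (canonicalWord M j) ≡ count (λ i → (inX10 M j i ∨ inX01 M j i) ∧ g (letterOf i)) (allFin n)
  count-canonicalWord g = trans (cong sum (sym (map-∘ (canonicalList M j))))
    (trans (count-↭ (g ∘ letterOf) canonicalList-↭)
           (count-filter (g ∘ letterOf) (λ i → inX10 M j i ∨ inX01 M j i) (allFin n)))

  count-a-canonicalWord : count isA (canonicalWord M j) ≡ sizeX10 M j
  count-a-canonicalWord = trans (count-canonicalWord isA)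
    (trans (count-cong listed-a (allFin n)) (sym (length-filter≡count (inX10 M j) (allFin n))))
    where
    listed-a : ∀ i → (inX10 M j i ∨ inX01 M j i) ∧ isA (letterOf i) ≡ inX10 M j i
    listed-a i with ent M i j | ent M i (suc j)
    ... | true  | true  = refl
    ... | true  | false = refl
    ... | false | true  = refl
    ... | false | false = refl

  count-b-canonicalWord : count isB (canonicalWord M j) ≡ length rowsX01
  count-b-canonicalWord = trans (count-canonicalWord isB)
    (trans (count-cong listed-b (allFin n)) (sym (length-filter≡count (inX01 M j) (allFin n))))
    where
    listed-b : ∀ i → (inX10 M j i ∨ inX01 M j i) ∧ isB (letterOf i) ≡ inX01 M j i
    listed-b i with ent M i j | ent M i (suc j)
    ... | true  | true  = refl
    ... | true  | false = refl
    ... | false | true  = refl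
    ... | false | false = refl

  letterOf-X10 : ∀ {i} → inX10 M j i ≡ true → letterOf i ≡ a
  letterOf-X10 i∈X10 rewrite i∈X10 = refl

  letterOf-X01 : ∀ {i} → inX01 M j i ≡ true → letterOf i ≡ b
  letterOf-X01 {i} i∈X01 with ent M i j | ent M i (suc j)
  letterOf-X01 () | true | _
  ... | false | _ = refl

  before⇒⊑ : ∀ {u v} → Listed u → Listed v → u before v → sortKey u ⊑ sortKey v
  before⇒⊑ {u} {v} u-listed v-listed u≤v =
    lexᵇ-sound {sortKey u} {sortKey v} (trans (sym (listedBefore≡lexᵇ u-listed v-listed)) u≤v)

  dominates⇒canonicalWord : X10Dominates →
    canonicalWord M j ≡ replicate (sizeX10 M j) a ++ replicate (length rowsX01) b
  dominates⇒canonicalWord dominates =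
    trans (sorted⇒replicate word-sorted)
          (cong₂ (λ p q → replicate p a ++ replicate q b) count-a-canonicalWord count-b-canonicalWord)
    where
    X10-first : ∀ {u v} → Listed u → Listed v → u before v → letterOf u ≼ letterOf v
    X10-first {u} {v} u-listed v-listed u≤v = ordered (before⇒⊑ u-listed v-listed u≤v) u-listed
      where
      ordered : sortKey u ⊑ sortKey v → Listed u → letterOf u ≼ letterOf v
      ordered u⊑v u-listed with inX10 M j u in u∈?X10 | inX10 M j v in v∈?X10
      ... | true  | _     = a≼
      ... | false | false = b≼b
      ... | false | true  =
        ⊥-elim (<⇒≱ (false⊑true⇒> u⊑v) (dominates v u v∈?X10 u-listed))

    word-sorted : AllPairs _≼_ (canonicalWord M j)
    word-sorted = AllPairs.map⁺ (AllPairs-mapWith X10-first canonicalList-listed canonicalList-sorted)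

  canonicalWord⇒ordered : ∀ p q → canonicalWord M j ≡ replicate p a ++ replicate q b →
    AllPairs (λ u v → letterOf u ≼ letterOf v) (canonicalList M j)
  canonicalWord⇒ordered p q word≡ = AllPairs.map⁻ (subst (AllPairs _≼_) (sym word≡) (replicate-sorted p q))

  canonicalWord⇒dominates : ∀ p q → canonicalWord M j ≡ replicate p a ++ replicate q b → X10Dominates
  canonicalWord⇒dominates p q word≡ x y x∈X10 y∈X01
    with AllPairs⇒∈-related (AllPairs.zip (canonicalList-sorted , canonicalWord⇒ordered p q word≡))
           (∈canonicalList (X10⇒listed x∈X10)) (∈canonicalList (X01⇒listed y∈X01))
  ... | inj₁ refl with () ← trans (sym (proj₁ (X10⇒entries x∈X10))) (proj₁ (X01⇒entries y∈X01))
  ... | inj₂ (inj₁ (x≤y , _)) = ⊑⇒≥ (before⇒⊑ (X10⇒listed x∈X10) (X01⇒listed y∈X01) x≤y)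
  ... | inj₂ (inj₂ (_ , y≼x)) with () ← subst₂ _≼_ (letterOf-X01 y∈X01) (letterOf-X10 x∈X10) y≼x

-- Column and row sums

ent-fromℕ< : ∀ {n} (M : Matrix n) i {l} (l<n : l < n) → ent M i (suc l) ≡ M i (fromℕ< l<n)
ent-fromℕ< {n} M i {l} l<n with l <? n
... | yes _    = refl
... | no  l≮n = ⊥-elim (l≮n l<n)

column-count : ∀ {n k} (M : Matrix n) → Uniform n k M → ∀ {l} → l < n →
  count (λ i → ent M i (suc l)) (allFin n) ≡ k
column-count {n} M (_ , columns) l<n =
  trans (count-cong (λ i → ent-fromℕ< M i l<n) (allFin n)) (columns (fromℕ< l<n))

uniform⇒balanced : ∀ {n k} (M : Matrix n) → Uniform n k M → ∀ {j} → 1 ≤ j → j < n →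
  length (rowsX10 M j) ≡ length (rowsX01 M j)
uniform⇒balanced {n} {k} M uniform {j@(suc j′)} _ j<n = begin
  length (rowsX10 M j)         ≡⟨ length-filter≡count (inX10 M j) (allFin n) ⟩
  count (inX10 M j) (allFin n) ≡⟨ +-cancelˡ-≡ (count (inX11 M j) (allFin n)) _ _ X11+X10≡X11+X01 ⟩
  count (inX01 M j) (allFin n) ≡⟨ length-filter≡count (inX01 M j) (allFin n) ⟨
  length (rowsX01 M j)         ∎
  where
  open ≡-Reasoning
  column column′ : Fin n → Bool
  column  i = ent M i j
  column′ i = ent M i (suc j)
  X11+X10≡X11+X01 : count (inX11 M j) (allFin n) + count (inX10 M j) (allFin n)
                  ≡ count (inX11 M j) (allFin n) + count (inX01 M j) (allFin n)
  X11+X10≡X11+X01 = begin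
    count (inX11 M j) (allFin n) + count (inX10 M j) (allFin n)
      ≡⟨ count-split column column′ (allFin n) ⟨
    count column (allFin n)  ≡⟨ column-count M uniform (<-trans (n<1+n j′) j<n) ⟩
    k                        ≡⟨ column-count M uniform j<n ⟨
    count column′ (allFin n) ≡⟨ count-split column′ column (allFin n) ⟩
    count (λ i → column′ i ∧ column i) (allFin n) + count (λ i → column′ i ∧ not (column i)) (allFin n)
      ≡⟨ cong₂ _+_ (count-cong (λ i → ∧-comm (column′ i) (column i)) (allFin n))
                   (count-cong (λ i → ∧-comm (column′ i) (not (column i))) (allFin n)) ⟩
    count (inX11 M j) (allFin n) + count (inX01 M j) (allFin n) ∎

tabulate≡applyUpTo : ∀ {A : Set} {m} (f : Fin m → A) (h : ℕ → A) → (∀ l → f l ≡ h (toℕ l)) →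
  tabulate f ≡ applyUpTo h m
tabulate≡applyUpTo {m = zero}  f h f≗h = refl
tabulate≡applyUpTo {m = suc m} f h f≗h =
  cong₂ _∷_ (f≗h Fin.zero) (tabulate≡applyUpTo (f ∘ Fin.suc) (h ∘ suc) (f≗h ∘ Fin.suc))

b2n≤1 : ∀ v → b2n v ≤ 1
b2n≤1 true  = ≤-refl
b2n≤1 false = z≤n

module _ {n : ℕ} (M : Matrix n) (i : Fin n) where

  S≤ : ∀ m → S M i m ≤ m
  S≤ zero    = z≤n
  S≤ (suc m) = subst (S M i (suc m) ≤_) (+-comm m 1) (+-mono-≤ (S≤ m) (b2n≤1 (ent M i (suc m))))

  S-mono : ∀ m d → S M i m ≤ S M i (m + d)
  S-mono m zero    = ≤-reflexive (cong (S M i) (sym (+-identityʳ m)))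
  S-mono m (suc d) rewrite +-suc m d = ≤-trans (S-mono m d) (m≤m+n _ _)

  S-+-≤ : ∀ m d → S M i (m + d) ≤ S M i m + d
  S-+-≤ m zero    = ≤-reflexive (trans (cong (S M i) (+-identityʳ m)) (sym (+-identityʳ _)))
  S-+-≤ m (suc d) rewrite +-suc m d = begin
    S M i (m + d) + b2n (ent M i (suc (m + d))) ≤⟨ +-mono-≤ (S-+-≤ m d) (b2n≤1 (ent M i (suc (m + d)))) ⟩
    S M i m + d + 1                               ≡⟨ +-assoc (S M i m) d 1 ⟩
    S M i m + (d + 1)                             ≡⟨ cong (S M i m +_) (+-comm d 1) ⟩
    S M i m + suc d                               ∎
    where open ≤-Reasoning

  S≡sum : ∀ m → S M i m ≡ sum (applyUpTo (λ l → b2n (ent M i (suc l))) m)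
  S≡sum zero    = refl
  S≡sum (suc m) = begin
    S M i m + b2n (ent M i (suc m))       ≡⟨ cong₂ _+_ (S≡sum m) (sym (+-identityʳ _)) ⟩
    sum xs + sum [ b2n (ent M i (suc m)) ] ≡⟨ sum-++ xs _ ⟨
    sum (xs ++ [ b2n (ent M i (suc m)) ])  ≡⟨ cong sum (applyUpTo-∷ʳ _ m) ⟩
    sum (applyUpTo (λ l → b2n (ent M i (suc l))) (suc m)) ∎
    where
    open ≡-Reasoning
    xs : List ℕ
    xs = applyUpTo (λ l → b2n (ent M i (suc l))) m

  S≡rowSum : S M i n ≡ rowSum M i
  S≡rowSum = begin
    S M i n                                               ≡⟨ S≡sum n ⟩
    sum (applyUpTo (λ l → b2n (ent M i (suc l))) n)      ≡⟨ cong sum (tabulate≡applyUpTo _ _ entry) ⟨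
    sum (tabulate (λ l → b2n (M i l)))
      ≡⟨ cong sum (map-tabulate (λ l → l) (λ l → b2n (M i l))) ⟨
    rowSum M i                                            ∎
    where
    open ≡-Reasoning
    entry : ∀ l → b2n (M i l) ≡ b2n (ent M i (suc (toℕ l)))
    entry l = cong b2n (sym (trans (ent-fromℕ< M i (toℕ<n l)) (cong (M i) (fromℕ<-toℕ l (toℕ<n l)))))

BoundaryIndex : ℕ → ℕ → Set
BoundaryIndex n m = m ≡ 1 ⊎ m ≡ 2 ⊎ m + 2 ≡ n ⊎ m + 1 ≡ n

boundary-≤ : ∀ {n j k sx sy} → sy < j → sy < k → 1 ≤ sx → j + k < n + sx → BoundaryIndex n j →
  sy ≤ sx
boundary-≤ (s≤s z≤n)  _ _    _ (inj₁ refl)        = z≤n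
boundary-≤ (s≤s sy≤1) _ 1≤sx _ (inj₂ (inj₁ refl)) = ≤-trans sy≤1 1≤sx
boundary-≤ {j = j} {k} {sx} _ sy<k _ j+k<n+sx (inj₂ (inj₂ (inj₁ refl))) =
  ≤-pred (≤-trans sy<k (≤-pred k<2+sx))
  where
  k<2+sx : k < 2 + sx
  k<2+sx = +-cancelˡ-< j k (2 + sx) (subst (j + k <_) (+-assoc j 2 sx) j+k<n+sx)
boundary-≤ {j = j} {k} {sx} _ sy<k _ j+k<n+sx (inj₂ (inj₂ (inj₂ refl))) =
  <⇒≤ (<-≤-trans sy<k (≤-pred k<1+sx))
  where
  k<1+sx : k < 1 + sx
  k<1+sx = +-cancelˡ-< j k (1 + sx) (subst (j + k <_) (+-assoc j 1 sx) j+k<n+sx)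

boundary⇒dominates : ∀ {n k} (M : Matrix n) → Uniform n k M → ∀ {j} → 1 ≤ j → j < n →
  BoundaryIndex n j ⊎ BoundaryIndex n k → X10Dominates M j
boundary⇒dominates {k = k} M uniform {J@(suc j)} _ J<n boundary x y x∈X10 y∈X01
  with o , refl ← m≤n⇒∃[o]m+o≡n J<n = Sum.[ boundary-≤ sy<J sy<k 1≤sx J+k<n+sx
                                          , boundary-≤ sy<k sy<J 1≤sx k+J<n+sx ] boundary
  where
  sx sy : ℕ
  sx = S M x J
  sy = S M y J

  row : ∀ i → S M i (suc J + o) ≡ k
  row i = trans (S≡rowSum M i) (proj₁ uniform i)

  sy<J : sy < J
  sy<J rewrite proj₁ (X01⇒entries M J y∈X01) = s≤s (subst (_≤ j) (sym (+-identityʳ _)) (S≤ M y j))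

  1≤sx : 1 ≤ sx
  1≤sx rewrite proj₁ (X10⇒entries M J x∈X10) = m≤n+m 1 (S M x j)

  S-next-y : S M y (suc J) ≡ suc sy
  S-next-y rewrite proj₂ (X01⇒entries M J y∈X01) = +-comm sy 1

  S-next-x : S M x (suc J) ≡ sx
  S-next-x rewrite proj₂ (X10⇒entries M J x∈X10) = +-identityʳ sx

  sy<k : sy < k
  sy<k = subst₂ _≤_ S-next-y (row y) (S-mono M y (suc J) o)

  k≤sx+o : k ≤ sx + o
  k≤sx+o = subst₂ _≤_ (row x) (cong (_+ o) S-next-x) (S-+-≤ M x (suc J) o)

  J+k<n+sx : J + k < suc J + o + sx
  J+k<n+sx = s≤s (subst (J + k ≤_) (trans (cong (J +_) (+-comm sx o)) (sym (+-assoc J o sx)))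
                                   (+-monoʳ-≤ J k≤sx+o))

  k+J<n+sx : k + J < suc J + o + sx
  k+J<n+sx = subst (_< suc J + o + sx) (+-comm J k) J+k<n+sx

allOptimal⇔canonicalWord : ∀ {n k} (M : Matrix n) → Uniform n k M → ∀ {j} → 1 ≤ j → j < n →
  AllIdAssignmentsOptimal M j ⇔
    (canonicalWord M j ≡ replicate (sizeX10 M j) a ++ replicate (sizeX10 M j) b)
allOptimal⇔canonicalWord M uniform {j} 1≤j j<n = mk⇔
  (λ optimal → trans (dominates⇒canonicalWord M j (optimal⇒dominates M j balanced optimal))
                     (cong (λ q → replicate (sizeX10 M j) a ++ replicate q b) (sym balanced)))
  (dominates⇒optimal M j ∘ canonicalWord⇒dominates M j (sizeX10 M j) (sizeX10 M j))
  where
  balanced : length (rowsX10 M j) ≡ length (rowsX01 M j)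
  balanced = uniform⇒balanced M uniform 1≤j j<n

boundary⇒allOptimal : ∀ {n k} (M : Matrix n) → Uniform n k M → ∀ {j} → 1 ≤ j → j < n →
  BoundaryIndex n j ⊎ BoundaryIndex n k → AllIdAssignmentsOptimal M j
boundary⇒allOptimal M uniform {j} 1≤j j<n =
  dominates⇒optimal M j ∘ boundary⇒dominates M uniform 1≤j j<n

lemma3p8 :
    ((n k : ℕ) (M : Matrix n) → Uniform n k M → (j : ℕ) → 1 ≤ j → j < n →
      AllIdAssignmentsOptimal M j ⇔
        (canonicalWord M j ≡ replicate (sizeX10 M j) a ++ replicate (sizeX10 M j) b))
    ×
    ((n k : ℕ) (M : Matrix n) → Uniform n k M → (j : ℕ) → 1 ≤ j → j < n →
      ((j ≡ 1 ⊎ j ≡ 2 ⊎ j + 2 ≡ n ⊎ j + 1 ≡ n) ⊎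
       (k ≡ 1 ⊎ k ≡ 2 ⊎ k + 2 ≡ n ⊎ k + 1 ≡ n)) →
      AllIdAssignmentsOptimal M j)
lemma3p8 = (λ n k M uniform j → allOptimal⇔canonicalWord M uniform {j})
         , (λ n k M uniform j → boundary⇒allOptimal M uniform {j})
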